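{- For every non-negative integer $n$, the multi-sets $$A_1(n)=\biguplus_{\lambda\vdash n}\{(a_v,l_v)\mid v\in\lambda\}\quad\text{and}\quad A_2(n)=\biguplus_{\lambda\vdash n}\{(a_v,f_v)\mid v\in\lambda\}$$ are equal. That is, for every pair $(c,d)$ of non-negative integers, the number of pairs $(\lambda,v)$ with $\lambda\vdash n$, $v\in\lambda$ and $(a_v,l_v)=(c,d)$ equals the number of pairs $(\lambda,v)$ with $\lambda\vdash n$, $v\in\lambda$ and $(a_v,f_v)=(c,d)$.
   Context: For an integer partition $\lambda=(\lambda_1\ge\lambda_2\ge\cdots)$ of $n$ (written $\lambda\vdash n$), identify $\lambda$ with its Ferrers (Young) diagram, the set of cells $v=[i,j]$ with $i\ge1$ and $1\le j\le\lambda_i$ ($i$ = row, $j$ = column). Let $\lambda'$ denote the conjugate partition, so $\lambda'_j$ is the length of column $j$. For a cell $v=[i,j]\in\lambda$ define the arm length $a_v=\lambda_i-j$, the leg length $l_v=\lambda'_j-i$, and the left length $f_v=j-1$. The unions over $\lambda\vdash n$ are multi-set unions (multiplicities add). -}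

module Defs where

open import Data.Nat using (ℕ; zero; suc; _+_; _∸_; _≤_; _≤?_; _≟_)
open import Data.List using (List; []; _∷_; map; concatMap; length; filter; upTo; applyUpTo)
open import Data.Nat.ListAction using (sum)
open import Data.List.Relation.Unary.All using (All)
open import Data.List.Relation.Unary.Linked using (Linked)
open import Data.Product using (_×_; _,_; Σ)
open import Data.Fin using (Fin; toℕ)
open import Relation.Nullary.Decidable using (Dec; _×-dec_)
open import Data.List.Relation.Unary.All using (all?)
open import Data.List.Relation.Unary.Linked using (linked?)
open import Data.Nat using (_≥?_)
open import Relation.Binary.PropositionalEquality using (_≡_)
open import Data.Nat using (_≥_)

IsPartition : ℕ → List ℕ → Set
IsPartition n λs = All (λ p → 1 ≤ p) λs × Linked _≥_ λs × sum λs ≡ n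

isPartition? : (n : ℕ) → (λs : List ℕ) → Dec (IsPartition n λs)
isPartition? n λs = all? (λ p → 1 ≤? p) λs ×-dec (linked? _≥?_ λs ×-dec (sum λs ≟ n))

listsOf : ℕ → ℕ → List (List ℕ)
listsOf zero    m = [] ∷ []
listsOf (suc k) m = concatMap (λ p → map (suc p ∷_) (listsOf k m)) (upTo m)

-- Candidates: all lists of length ≤ n with entries in {1,…,n}; every partition of n
-- is among them exactly once.
candidates : ℕ → List (List ℕ)
candidates n = concatMap (λ k → listsOf k n) (upTo (suc n))

partitions : ℕ → List (List ℕ)
partitions n = filter (isPartition? n) (candidates n)

conjPart : List ℕ → ℕ → ℕ
conjPart λs j = length (filter (λ p → j ≤? p) λs)

-- Cells [i,j] of the diagram (1-indexed), listed row by row.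
cellsFrom : ℕ → List ℕ → List (ℕ × ℕ)
cellsFrom i []        = []
cellsFrom i (p ∷ ps) = applyUpTo (λ j₀ → (i , suc j₀)) p Data.List.++ cellsFrom (suc i) ps

cells : List ℕ → List (ℕ × ℕ)
cells = cellsFrom 1

-- λ_i (1-indexed row length; 0 beyond the last row)
row : List ℕ → ℕ → ℕ
row []       _             = 0
row (p ∷ ps) zero          = 0
row (p ∷ ps) (suc zero)    = p
row (p ∷ ps) (suc (suc i)) = row ps (suc i)

arm leg left : List ℕ → ℕ × ℕ → ℕ
arm  λs (i , j) = row λs i ∸ j
leg  λs (i , j) = conjPart λs j ∸ i
left λs (i , j) = j ∸ 1

A₁ : ℕ → List (ℕ × ℕ)
A₁ n = concatMap (λ λs → map (λ v → (arm λs v , leg λs v)) (cells λs)) (partitions n)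

A₂ : ℕ → List (ℕ × ℕ)
A₂ n = concatMap (λ λs → map (λ v → (arm λs v , left λs v)) (cells λs)) (partitions n)

count : ℕ × ℕ → List (ℕ × ℕ) → ℕ
count (c , d) xs = length (filter (λ { (x , y) → (x ≟ c) ×-dec (y ≟ d) }) xs)

{-# OPTIONS --with-K #-}
-- Write h = c + 1 + d. A cell has arm c and left length d exactly when its row has length h, and
-- arm c and leg d exactly when it is the corner of a removable rim hook of length h. Both counts
-- T(n) vanish for n < h and satisfy T(m + h) = T(m) + p(m): deleting the part (resp. the rim hook)
-- at row k is a bijection from the pairs (λ ⊢ m + h, k) with a removable part (hook) at row k onto
-- the pairs (μ ⊢ m, k) for which a part (hook) can be inserted at row k, and in every μ the
-- insertable rows outnumber the removable ones by exactly one, since along the rows the two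
-- conditions telescope.
module Submission where

open import Defs
open import Data.Bool using (Bool; true; false; _∧_; T; T?)
open import Data.Bool.Properties using (T-∧)
open import Data.Empty using (⊥; ⊥-elim)
open import Data.List using (List; []; _∷_; _++_; map; concatMap; length; filterᵇ; upTo; applyUpTo)
open import Data.List.Properties using (length-map; length-++; map-++; map-∘)
open import Data.List.Membership.Propositional using (_∈_; find; lose)
open import Data.List.Membership.Propositional.Properties
open import Data.List.Membership.Propositional.Properties.WithK using (unique∧set⇒bag)
open import Data.List.Relation.Binary.BagAndSetEquality using (∼bag⇒↭)
open import Data.List.Relation.Binary.Permutation.Propositional.Properties using (↭-length)
open import Data.List.Relation.Unary.All as All using (All; []; _∷_)
open import Data.List.Relation.Unary.AllPairs using ([]; _∷_)
open import Data.List.Relation.Unary.Any using (here; there)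
open import Data.List.Relation.Unary.Linked as Linked using (Linked; []; [-]; _∷_)
open import Data.List.Relation.Unary.Unique.Propositional using (Unique)
import Data.List.Relation.Unary.Unique.Propositional.Properties as Unique
open import Data.Nat
open import Data.Nat.Induction using (<-rec)
open import Data.Nat.ListAction using (sum)
open import Data.Nat.ListAction.Properties using (sum-++)
open import Data.Nat.Properties
open import Algebra.Properties.CommutativeSemigroup +-commutativeSemigroup using (x∙yz≈y∙xz)
open import Data.Nat.Tactic.RingSolver using (solve-∀)
open import Data.Product using (_×_; _,_; proj₁; proj₂)
open import Data.Sum using (inj₁; inj₂)
open import Data.Unit using (tt)
open import Function using (_∘_)
open import Function.Bundles using (Equivalence; mk⇔)
open import Relation.Binary.Definitions using (Tri; tri<; tri≈; tri>)
open import Relation.Binary.PropositionalEquality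
open import Relation.Nullary using (¬_; yes; no)

χ : Bool → ℕ
χ true  = 1
χ false = 0

_◂_ : ℕ → (ℕ → ℕ) → ℕ → ℕ
(x ◂ f) zero    = x
(x ◂ f) (suc m) = f m

shift : ℕ → (ℕ → ℕ) → ℕ → ℕ
shift zero    f = f
shift (suc k) f = shift k (f ∘ suc)

shift-apply : ∀ k f m → shift k f m ≡ f (k + m)
shift-apply zero    f m = refl
shift-apply (suc k) f m = shift-apply k (f ∘ suc) m

shift-suc : ∀ k f → shift k f ∘ suc ≡ shift k (f ∘ suc)
shift-suc zero    f = refl
shift-suc (suc k) f = shift-suc k (f ∘ suc)

shift-head : ∀ k f → shift k f 0 ≡ f k
shift-head zero    f = refl
shift-head (suc k) f = shift-head k (f ∘ suc)

shift-cong : ∀ k {f g} → f ≗ g → shift k f ≗ shift k g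
shift-cong zero    eq = eq
shift-cong (suc k) eq = shift-cong k (eq ∘ suc)

Σ< : (ℕ → ℕ) → ℕ → ℕ
Σ< f zero    = 0
Σ< f (suc N) = f 0 + Σ< (f ∘ suc) N

Σ<-cong : ∀ {f g} N → (∀ m → m < N → f m ≡ g m) → Σ< f N ≡ Σ< g N
Σ<-cong zero    eq = refl
Σ<-cong (suc N) eq = cong₂ _+_ (eq 0 z<s) (Σ<-cong N (λ m m<N → eq (suc m) (s<s m<N)))

Σ<-shift : ∀ f k N → Σ< f (k + N) ≡ Σ< f k + Σ< (shift k f) N
Σ<-shift f zero    N = refl
Σ<-shift f (suc k) N = trans (cong (f 0 +_) (Σ<-shift (f ∘ suc) k N)) (sym (+-assoc (f 0) _ _))

Σ<-zero : ∀ {f} N → (∀ m → f m ≡ 0) → Σ< f N ≡ 0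
Σ<-zero zero    z = refl
Σ<-zero (suc N) z = cong₂ _+_ (z 0) (Σ<-zero N (z ∘ suc))

Σ<-tail-zero : ∀ {f a b} → a ≤ b → (∀ m → a ≤ m → f m ≡ 0) → Σ< f b ≡ Σ< f a
Σ<-tail-zero {f} {a} {b} a≤b z = begin
  Σ< f b                               ≡⟨ cong (Σ< f) (sym (m+[n∸m]≡n a≤b)) ⟩
  Σ< f (a + (b ∸ a))                   ≡⟨ Σ<-shift f a (b ∸ a) ⟩
  Σ< f a + Σ< (shift a f) (b ∸ a)      ≡⟨ cong (Σ< f a +_) (Σ<-zero (b ∸ a) tail) ⟩
  Σ< f a + 0                           ≡⟨ +-identityʳ _ ⟩
  Σ< f a                               ∎
  where
  open ≡-Reasoning
  tail : ∀ m → shift a f m ≡ 0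
  tail m = trans (shift-apply a f m) (z (a + m) (m≤m+n a m))

Σ<-mono : ∀ f {a b} → a ≤ b → Σ< f a ≤ Σ< f b
Σ<-mono f {a} {b} a≤b = begin
  Σ< f a                                       ≤⟨ m≤m+n _ _ ⟩
  Σ< f a + Σ< (shift a f) (b ∸ a)              ≡⟨ sym (Σ<-shift f a (b ∸ a)) ⟩
  Σ< f (a + (b ∸ a))                           ≡⟨ cong (Σ< f) (m+[n∸m]≡n a≤b) ⟩
  Σ< f b                                       ∎
  where open ≤-Reasoning

Σ<-positive : ∀ {f} N → (∀ m → m < N → 0 < f m) → N ≤ Σ< f N
Σ<-positive zero    pos = z≤n
Σ<-positive (suc N) pos = +-mono-≤ (pos 0 z<s) (Σ<-positive N (λ m m<N → pos (suc m) (s<s m<N)))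

Antitone : (ℕ → ℕ) → Set
Antitone f = ∀ m → f (suc m) ≤ f m

antitone-mono : ∀ {f} → Antitone f → ∀ {m m'} → m ≤ m' → f m' ≤ f m
antitone-mono {f} anti {m} m≤m' with m≤n⇒∃[o]m+o≡n m≤m'
... | o , refl = go o
  where
  go : ∀ o → f (m + o) ≤ f m
  go zero    = ≤-reflexive (cong f (+-identityʳ m))
  go (suc o) = ≤-trans (subst (λ x → f x ≤ f (m + o)) (sym (+-suc m o)) (anti (m + o))) (go o)

antitone-vanish : ∀ {f} → Antitone f → ∀ {a m} → f a ≡ 0 → a ≤ m → f m ≡ 0
antitone-vanish {f} anti {m = m} fa≡0 a≤m = n≤0⇒n≡0 (subst (f m ≤_) fa≡0 (antitone-mono anti a≤m))

shift-antitone : ∀ {f} k → Antitone f → Antitone (shift k f)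
shift-antitone zero    anti = anti
shift-antitone (suc k) anti = shift-antitone k (anti ∘ suc)

◂-antitone : ∀ {x f} → f 0 ≤ x → Antitone f → Antitone (x ◂ f)
◂-antitone f0≤x anti zero    = f0≤x
◂-antitone f0≤x anti (suc m) = anti m

record IsPartitionFn (n : ℕ) (f : ℕ → ℕ) : Set where
  field
    antitone : Antitone f
    vanishes : f n ≡ 0
    total    : Σ< f n ≡ n

  vanishes-beyond : ∀ {m} → n ≤ m → f m ≡ 0
  vanishes-beyond = antitone-vanish antitone vanishes

isPartitionFn : ∀ {f N m} → Antitone f → f N ≡ 0 → Σ< f N ≡ m → IsPartitionFn m f
isPartitionFn {f} {N} {m} anti fN≡0 sumN with ≤-total N m
... | inj₁ N≤m = record
  { antitone = anti
  ; vanishes = antitone-vanish anti fN≡0 N≤m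
  ; total    = trans (Σ<-tail-zero N≤m (λ _ → antitone-vanish anti fN≡0)) sumN }
... | inj₂ m≤N = record
  { antitone = anti
  ; vanishes = fm≡0
  ; total    = trans (sym (Σ<-tail-zero m≤N (λ _ → antitone-vanish anti fm≡0))) sumN }
  where
  fm≡0 : f m ≡ 0
  fm≡0 with f m in fm | m≤n⇒m<n∨m≡n m≤N
  ... | zero  | _         = refl
  ... | suc _ | inj₂ refl = trans (sym fm) fN≡0
  ... | suc _ | inj₁ m<N  = ⊥-elim (<-irrefl (sym sumN) (begin-strict
    m                    <⟨ Σ<-positive (suc m) (λ j j≤m → <-≤-trans (subst (0 <_) (sym fm) z<s)
                                                                    (antitone-mono anti (s≤s⁻¹ j≤m))) ⟩
    Σ< f (suc m)         ≤⟨ Σ<-mono f m<N ⟩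
    Σ< f N               ∎))
    where open ≤-Reasoning

T⇒≡true : ∀ {b} → T b → b ≡ true
T⇒≡true {true} _ = refl

¬T⇒≡false : ∀ {b} → ¬ T b → b ≡ false
¬T⇒≡false {false} _  = refl
¬T⇒≡false {true}  ¬t = ⊥-elim (¬t tt)

T-ext : ∀ {a b} → (T a → T b) → (T b → T a) → a ≡ b
T-ext {false} {false} _ _ = refl
T-ext {false} {true}  _ g = ⊥-elim (g tt)
T-ext {true}  {false} f _ = ⊥-elim (f tt)
T-ext {true}  {true}  _ _ = refl

χ-false : ∀ {b} → ¬ T b → χ b ≡ 0
χ-false ¬t = cong χ (¬T⇒≡false ¬t)

-- part xs k is the paper's λ_{k+1}: from here on rows are numbered from 0.
part : List ℕ → ℕ → ℕ
part xs k = row xs (suc k)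

part-beyond : ∀ xs {m} → length xs ≤ m → part xs m ≡ 0
part-beyond []       _   = refl
part-beyond (x ∷ xs) {suc m} len≤m = part-beyond xs (s≤s⁻¹ len≤m)

Σ<-part : ∀ xs → Σ< (part xs) (length xs) ≡ sum xs
Σ<-part []       = refl
Σ<-part (x ∷ xs) = cong (x +_) (Σ<-part xs)

linked⇒antitone : ∀ {xs} → Linked _≥_ xs → Antitone (part xs)
linked⇒antitone []          _       = z≤n
linked⇒antitone [-]         _       = z≤n
linked⇒antitone (x≥y ∷ _)   zero    = x≥y
linked⇒antitone (_   ∷ xs)  (suc m) = linked⇒antitone xs m

antitone⇒linked : ∀ xs → Antitone (part xs) → Linked _≥_ xs
antitone⇒linked []           _    = []
antitone⇒linked (x ∷ [])     _    = [-]
antitone⇒linked (x ∷ y ∷ xs) anti = anti 0 ∷ antitone⇒linked (y ∷ xs) (anti ∘ suc)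

IsPartition⇒IsPartitionFn : ∀ {n xs} → IsPartition n xs → IsPartitionFn n (part xs)
IsPartition⇒IsPartitionFn {xs = xs} (_ , linked , sum≡n) =
  isPartitionFn (linked⇒antitone linked) (part-beyond xs ≤-refl) (trans (Σ<-part xs) sum≡n)

part-injective : ∀ {xs ys} → All (1 ≤_) xs → All (1 ≤_) ys → part xs ≗ part ys → xs ≡ ys
part-injective []          []          _  = refl
part-injective []          (1≤y ∷ _)   eq = ⊥-elim (<⇒≢ 1≤y (eq 0))
part-injective (1≤x ∷ _)   []          eq = ⊥-elim (<⇒≢ 1≤x (sym (eq 0)))
part-injective (_ ∷ pxs)   (_ ∷ pys)   eq = cong₂ _∷_ (eq 0) (part-injective pxs pys (eq ∘ suc))

partList : (ℕ → ℕ) → ℕ → List ℕ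
partList f zero    = []
partList f (suc K) with f 0
... | zero  = []
... | suc p = suc p ∷ partList (f ∘ suc) K

partList-positive : ∀ f K → All (1 ≤_) (partList f K)
partList-positive f zero = []
partList-positive f (suc K) with f 0
... | zero  = []
... | suc p = s≤s z≤n ∷ partList-positive (f ∘ suc) K

length-partList : ∀ f K → length (partList f K) ≤ K
length-partList f zero = z≤n
length-partList f (suc K) with f 0
... | zero  = z≤n
... | suc p = s≤s (length-partList (f ∘ suc) K)

part-partList : ∀ {f} K → Antitone f → f K ≡ 0 → part (partList f K) ≗ f
part-partList {f} zero anti f0≡0 m = sym (antitone-vanish anti f0≡0 z≤n)
part-partList {f} (suc K) anti fK≡0 m with f 0 in f0
... | zero  = sym (antitone-vanish anti f0 z≤n)
... | suc p with m
...   | zero   = sym f0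
...   | suc m' = part-partList K (anti ∘ suc) fK≡0 m'

partList-part : ∀ {n xs f} → IsPartition n xs → IsPartitionFn n f → f ≗ part xs → partList f n ≡ xs
partList-part {n} {f = f} (pos , _) pf eq =
  part-injective (partList-positive f n) pos (λ j → trans (part-partList n antitone vanishes j) (eq j))
  where open IsPartitionFn pf

IsPartitionFn⇒IsPartition : ∀ {n f} → IsPartitionFn n f → IsPartition n (partList f n)
IsPartitionFn⇒IsPartition {n} {f} pf =
  partList-positive f n ,
  antitone⇒linked xs (λ m → subst₂ _≤_ (sym (part≗f (suc m))) (sym (part≗f m)) (antitone m)) ,
  (begin
    sum xs                      ≡⟨ sym (Σ<-part xs) ⟩
    Σ< (part xs) (length xs)    ≡⟨ sym (Σ<-tail-zero (length-partList f n) (λ _ → part-beyond xs)) ⟩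
    Σ< (part xs) n              ≡⟨ Σ<-cong n (λ m _ → part≗f m) ⟩
    Σ< f n                      ≡⟨ total ⟩
    n                           ∎)
  where
  open IsPartitionFn pf
  open ≡-Reasoning
  xs = partList f n
  part≗f = part-partList n antitone vanishes

Unique-concatMap : ∀ {A B : Set} (κ : B → A) (f : A → List B) {xs} → Unique xs →
  (∀ x → Unique (f x)) → (∀ x {b} → b ∈ f x → κ b ≡ x) → Unique (concatMap f xs)
Unique-concatMap κ f {[]}     []          _     _      = []
Unique-concatMap κ f {x ∷ xs} (x∉ ∷ uxs) ufx   κ-inv =
  Unique.++⁺ (ufx x) (Unique-concatMap κ f uxs ufx κ-inv) disjoint
  where
  disjoint : ∀ {v} → v ∈ f x × v ∈ concatMap f xs → ⊥
  disjoint (v∈fx , v∈rest) with ∈-concat⁻′ (map f xs) v∈rest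
  ... | ys , v∈ys , ys∈ with ∈-map⁻ f ys∈
  ...   | y , y∈xs , refl = All.lookup x∉ y∈xs (trans (sym (κ-inv x v∈fx)) (κ-inv y v∈ys))

length-listsOf : ∀ k m {ys} → ys ∈ listsOf k m → length ys ≡ k
length-listsOf zero    m (here refl) = refl
length-listsOf (suc k) m ys∈ with find (∈-concatMap⁻ (λ p → map (suc p ∷_) (listsOf k m)) {xs = upTo m} ys∈)
... | p , _ , ys∈′ with ∈-map⁻ (suc p ∷_) ys∈′
...   | zs , zs∈ , refl = cong suc (length-listsOf k m zs∈)

listsOf-unique : ∀ k m → Unique (listsOf k m)
listsOf-unique zero    m = [] ∷ []
listsOf-unique (suc k) m =
  Unique-concatMap predHead (λ p → map (suc p ∷_) (listsOf k m)) (Unique.upTo⁺ m)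
    (λ p → Unique.map⁺ (λ { refl → refl }) (listsOf-unique k m))
    predHead-inv
  where
  predHead : List ℕ → ℕ
  predHead []      = 0
  predHead (y ∷ _) = pred y
  predHead-inv : ∀ p {ys} → ys ∈ map (suc p ∷_) (listsOf k m) → predHead ys ≡ p
  predHead-inv p ys∈ with ∈-map⁻ (suc p ∷_) ys∈
  ... | _ , _ , refl = refl

partitions-unique : ∀ n → Unique (partitions n)
partitions-unique n = Unique.filter⁺ (isPartition? n)
  (Unique-concatMap length (λ k → listsOf k n) (Unique.upTo⁺ (suc n))
    (λ k → listsOf-unique k n) (λ k → length-listsOf k n))

∈-listsOf : ∀ m ys → All (λ p → 1 ≤ p × p ≤ m) ys → ys ∈ listsOf (length ys) m
∈-listsOf m []           []               = here refl
∈-listsOf m (suc p ∷ ys) ((_ , p<m) ∷ bds) =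
  ∈-concatMap⁺ (λ q → map (suc q ∷_) (listsOf (length ys) m))
    (lose (∈-upTo⁺ p<m) (∈-map⁺ (suc p ∷_) (∈-listsOf m ys bds)))

length≤sum : ∀ {xs} → All (1 ≤_) xs → length xs ≤ sum xs
length≤sum []          = z≤n
length≤sum (1≤x ∷ pxs) = +-mono-≤ 1≤x (length≤sum pxs)

parts≤sum : ∀ xs → All (_≤ sum xs) xs
parts≤sum []       = []
parts≤sum (x ∷ xs) = m≤m+n x (sum xs) ∷ All.map (λ y≤ → ≤-trans y≤ (m≤n+m (sum xs) x)) (parts≤sum xs)

∈-partitions⁺ : ∀ {n xs} → IsPartition n xs → xs ∈ partitions n
∈-partitions⁺ {n} {xs} isP@(pos , _ , refl) = ∈-filter⁺ (isPartition? n)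
  (∈-concatMap⁺ (λ k → listsOf k n)
    (lose (∈-upTo⁺ (s≤s (length≤sum pos)))
          (∈-listsOf n xs (All.zip (pos , parts≤sum xs)))))
  isP

∈-partitions⁻ : ∀ {n xs} → xs ∈ partitions n → IsPartition n xs
∈-partitions⁻ {n} xs∈ = proj₂ (∈-filter⁻ (isPartition? n) {xs = candidates n} xs∈)

map-unique : ∀ {A B : Set} (F : A → B) (G : B → A) {xs} → Unique xs →
  (∀ {x} → x ∈ xs → G (F x) ≡ x) → Unique (map F xs)
map-unique F G {[]}     []          _  = []
map-unique F G {x ∷ xs} (x∉ ∷ uxs) GF = fresh x∉ (GF ∘ there) ∷ map-unique F G uxs (GF ∘ there)
  where
  fresh : ∀ {ys} → All (x ≢_) ys → (∀ {y} → y ∈ ys → G (F y) ≡ y) → All (F x ≢_) (map F ys)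
  fresh []          _   = []
  fresh (x≢y ∷ x∉) GFys =
    (λ Fx≡Fy → x≢y (trans (sym (GF (here refl))) (trans (cong G Fx≡Fy) (GFys (here refl)))))
    ∷ fresh x∉ (GFys ∘ there)

length-inverse : ∀ {A B : Set} {xs : List A} {ys : List B} → Unique xs → Unique ys →
  (F : A → B) (G : B → A) → (∀ {x} → x ∈ xs → F x ∈ ys) → (∀ {y} → y ∈ ys → G y ∈ xs) →
  (∀ {x} → x ∈ xs → G (F x) ≡ x) → (∀ {y} → y ∈ ys → F (G y) ≡ y) → length xs ≡ length ys
length-inverse {xs = xs} {ys} uxs uys F G F∈ G∈ GF FG =
  trans (sym (length-map F xs))
        (↭-length (∼bag⇒↭ (unique∧set⇒bag (map-unique F G uxs GF) uys (mk⇔ to from))))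
  where
  to : ∀ {z} → z ∈ map F xs → z ∈ ys
  to z∈ with ∈-map⁻ F z∈
  ... | x , x∈ , refl = F∈ x∈
  from : ∀ {z} → z ∈ ys → z ∈ map F xs
  from z∈ = subst (_∈ map F xs) (FG z∈) (∈-map⁺ F (G∈ z∈))

positions : List (List ℕ) → (List ℕ → ℕ → Bool) → ℕ → List (List ℕ × ℕ)
positions L P N = concatMap (λ xs → map (xs ,_) (filterᵇ (P xs) (upTo N))) L

length-filterᵇ-applyUpTo : ∀ (p : ℕ → Bool) f N →
  length (filterᵇ p (applyUpTo f N)) ≡ Σ< (χ ∘ p ∘ f) N
length-filterᵇ-applyUpTo p f zero = refl
length-filterᵇ-applyUpTo p f (suc N) with p (f 0)
... | true  = cong suc (length-filterᵇ-applyUpTo p (f ∘ suc) N)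
... | false = length-filterᵇ-applyUpTo p (f ∘ suc) N

length-positions : ∀ L P N → length (positions L P N) ≡ sum (map (λ xs → Σ< (χ ∘ P xs) N) L)
length-positions []       P N = refl
length-positions (xs ∷ L) P N =
  trans (length-++ (map (xs ,_) (filterᵇ (P xs) (upTo N))))
        (cong₂ _+_ (trans (length-map (xs ,_) (filterᵇ (P xs) (upTo N))) (length-filterᵇ-applyUpTo (P xs) (λ k → k) N))
                   (length-positions L P N))

∈-positions⁺ : ∀ {L P N xs k} → xs ∈ L → k < N → T (P xs k) → (xs , k) ∈ positions L P N
∈-positions⁺ {P = P} {N} {xs} xs∈ k<N Pxsk =
  ∈-concatMap⁺ (λ ys → map (ys ,_) (filterᵇ (P ys) (upTo N)))
    (lose xs∈ (∈-map⁺ (xs ,_) (∈-filter⁺ (T? ∘ P xs) (∈-upTo⁺ k<N) Pxsk)))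

∈-positions⁻ : ∀ {L P N xs k} → (xs , k) ∈ positions L P N → xs ∈ L × k < N × T (P xs k)
∈-positions⁻ {L} {P} {N} p∈ with find (∈-concatMap⁻ (λ ys → map (ys ,_) (filterᵇ (P ys) (upTo N))) {xs = L} p∈)
... | ys , ys∈ , p∈′ with ∈-map⁻ (ys ,_) p∈′
...   | k , k∈ , refl with ∈-filter⁻ (T? ∘ P ys) {xs = upTo N} k∈
...     | k∈upTo , Pysk = ys∈ , ∈-upTo⁻ k∈upTo , Pysk

positions-unique : ∀ {L} P N → Unique L → Unique (positions L P N)
positions-unique P N uL = Unique-concatMap proj₁ (λ ys → map (ys ,_) (filterᵇ (P ys) (upTo N))) uL
  (λ ys → Unique.map⁺ (λ { refl → refl }) (Unique.filter⁺ (T? ∘ P ys) (Unique.upTo⁺ N)))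
  first-inv
  where
  first-inv : ∀ ys {b} → b ∈ map (ys ,_) (filterᵇ (P ys) (upTo N)) → proj₁ b ≡ ys
  first-inv ys b∈ with ∈-map⁻ (ys ,_) b∈
  ... | _ , _ , refl = refl

χ-exchange : ∀ x y z → (¬ T y → T x × T z) → χ (x ∧ y) + χ z ≡ χ (y ∧ z) + χ x
χ-exchange true  true  true  _ = refl
χ-exchange true  true  false _ = refl
χ-exchange false true  true  _ = refl
χ-exchange false true  false _ = refl
χ-exchange true  false true  _ = refl
χ-exchange false false _     h = ⊥-elim (proj₁ (h λ ()))
χ-exchange _     false false h = ⊥-elim (proj₂ (h λ ()))

telescope : (X Y : ℕ → Bool) → (∀ k → ¬ T (Y k) → T (X k) × T (X (suc k))) → ∀ N →
  Σ< (λ k → χ (X k ∧ Y k)) N + χ (X N) ≡ Σ< (λ k → χ (Y k ∧ X (suc k))) N + χ (X 0)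
telescope X Y exch zero    = refl
telescope X Y exch (suc N) = begin
  a + Σ< Q′ N + χ (X (suc N))    ≡⟨ +-assoc a (Σ< Q′ N) _ ⟩
  a + (Σ< Q′ N + χ (X (suc N)))  ≡⟨ cong (a +_) (telescope (X ∘ suc) (Y ∘ suc) (exch ∘ suc) N) ⟩
  a + (Σ< P′ N + χ (X 1))        ≡⟨ x∙yz≈y∙xz a (Σ< P′ N) (χ (X 1)) ⟩
  Σ< P′ N + (a + χ (X 1))        ≡⟨ cong (Σ< P′ N +_) (χ-exchange (X 0) (Y 0) (X 1) (exch 0)) ⟩
  Σ< P′ N + (b + χ (X 0))        ≡⟨ x∙yz≈y∙xz (Σ< P′ N) b (χ (X 0)) ⟩
  b + (Σ< P′ N + χ (X 0))        ≡⟨ sym (+-assoc b (Σ< P′ N) _) ⟩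
  b + Σ< P′ N + χ (X 0)          ∎
  where
  open ≡-Reasoning
  a = χ (X 0 ∧ Y 0)
  b = χ (Y 0 ∧ X 1)
  Q′ P′ : ℕ → ℕ
  Q′ k = χ (X (suc k) ∧ Y (suc k))
  P′ k = χ (Y (suc k) ∧ X (suc (suc k)))

atRow : ℕ → ((ℕ → ℕ) → ℕ → ℕ) → (ℕ → ℕ) → ℕ → ℕ
atRow zero    φ f = φ f
atRow (suc k) φ f = f 0 ◂ atRow k φ (f ∘ suc)

shift-atRow : ∀ k φ f → shift k (atRow k φ f) ≡ φ (shift k f)
shift-atRow zero    φ f = refl
shift-atRow (suc k) φ f = shift-atRow k φ (f ∘ suc)

atRow-prefix : ∀ k φ f {m} → m < k → atRow k φ f m ≡ f m
atRow-prefix (suc k) φ f {zero}  _   = refl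
atRow-prefix (suc k) φ f {suc m} m<k = atRow-prefix k φ (f ∘ suc) (s<s⁻¹ m<k)

atRow-beyond : ∀ k φ f N → atRow k φ f (k + N) ≡ φ (shift k f) N
atRow-beyond zero    φ f N = refl
atRow-beyond (suc k) φ f N = atRow-beyond k φ (f ∘ suc) N

atRow-cong : ∀ k φ → (∀ {g g'} → g ≗ g' → φ g ≗ φ g') → ∀ {f f'} → f ≗ f' → atRow k φ f ≗ atRow k φ f'
atRow-cong zero    φ φ-cong eq         = φ-cong eq
atRow-cong (suc k) φ φ-cong eq zero    = eq 0
atRow-cong (suc k) φ φ-cong eq (suc m) = atRow-cong k φ φ-cong (eq ∘ suc) m

atRow-inverse : ∀ k φ ψ f → ψ (φ (shift k f)) ≗ shift k f → atRow k ψ (atRow k φ f) ≗ f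
atRow-inverse zero    φ ψ f inv         = inv
atRow-inverse (suc k) φ ψ f inv zero    = refl
atRow-inverse (suc k) φ ψ f inv (suc m) = atRow-inverse k φ ψ (f ∘ suc) inv m

atRow-antitone : ∀ k φ {f} → Antitone f → Antitone (φ (shift (suc k) f)) → φ (shift (suc k) f) 0 ≤ f k →
  Antitone (atRow (suc k) φ f)
atRow-antitone zero    φ anti antiφ below = ◂-antitone below antiφ
atRow-antitone (suc k) φ anti antiφ below = ◂-antitone (anti 0) (atRow-antitone k φ (anti ∘ suc) antiφ below)

Σ<-atRow : ∀ k φ f N → Σ< (atRow k φ f) (k + N) ≡ Σ< f k + Σ< (φ (shift k f)) N
Σ<-atRow zero    φ f N = refl
Σ<-atRow (suc k) φ f N = trans (cong (f 0 +_) (Σ<-atRow k φ (f ∘ suc) N)) (sym (+-assoc (f 0) _ _))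

sum-map-cong : ∀ {A : Set} {f g : A → ℕ} L → (∀ {x} → x ∈ L → f x ≡ g x) → sum (map f L) ≡ sum (map g L)
sum-map-cong []      eq = refl
sum-map-cong (x ∷ L) eq = cong₂ _+_ (eq (here refl)) (sum-map-cong L (eq ∘ there))

sum-map-zero : ∀ {A : Set} {f : A → ℕ} L → (∀ {x} → x ∈ L → f x ≡ 0) → sum (map f L) ≡ 0
sum-map-zero []      eq = refl
sum-map-zero (x ∷ L) eq = cong₂ _+_ (eq (here refl)) (sum-map-zero L (eq ∘ there))

sum-map-+1 : ∀ {A : Set} (f : A → ℕ) L → sum (map (λ x → f x + 1) L) ≡ sum (map f L) + length L
sum-map-+1 f []      = refl
sum-map-+1 f (x ∷ L) = begin
  f x + 1 + sum (map (λ x → f x + 1) L)  ≡⟨ cong (f x + 1 +_) (sum-map-+1 f L) ⟩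
  f x + 1 + (sum (map f L) + length L)  ≡⟨ +-assoc (f x) 1 _ ⟩
  f x + (1 + (sum (map f L) + length L)) ≡⟨ cong (f x +_) (sym (+-suc (sum (map f L)) (length L))) ⟩
  f x + (sum (map f L) + suc (length L)) ≡⟨ sym (+-assoc (f x) _ _) ⟩
  f x + sum (map f L) + suc (length L)   ∎
  where open ≡-Reasoning

sum-map-++ : ∀ {A : Set} (g : A → ℕ) xs ys → sum (map g (xs ++ ys)) ≡ sum (map g xs) + sum (map g ys)
sum-map-++ g xs ys = trans (cong sum (map-++ g xs ys)) (sum-++ (map g xs) (map g ys))

sum-map-concatMap : ∀ {A B : Set} (g : B → ℕ) (F : A → List B) xs →
  sum (map g (concatMap F xs)) ≡ sum (map (λ x → sum (map g (F x))) xs)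
sum-map-concatMap g F []       = refl
sum-map-concatMap g F (x ∷ xs) = trans (sum-map-++ g (F x) (concatMap F xs)) (cong (sum (map g (F x)) +_) (sum-map-concatMap g F xs))

sum-map-applyUpTo : ∀ {A : Set} (g : A → ℕ) (f : ℕ → A) p → sum (map g (applyUpTo f p)) ≡ Σ< (g ∘ f) p
sum-map-applyUpTo g f zero    = refl
sum-map-applyUpTo g f (suc p) = cong (g (f 0) +_) (sum-map-applyUpTo g (f ∘ suc) p)

-- Surgery at row k keeps rows 0, …, k-1 of a diagram and applies cut₀ (removing h cells) or
-- paste₀ (adding h cells) to the remaining rows s = shift k f. Row k is removable when fits s
-- holds and row k is long enough to stay above paste₀ of the rows below it (supports); it is
-- insertable when fits s holds and row k-1 is long enough to stay above paste₀ s (opens).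
module Surgery (h : ℕ) (fits : (ℕ → ℕ) → Bool) (cut₀ paste₀ : (ℕ → ℕ) → ℕ → ℕ) where

  supports : (ℕ → ℕ) → Bool
  supports f = paste₀ (f ∘ suc) 0 ≤ᵇ f 0

  removable₀ : (ℕ → ℕ) → Bool
  removable₀ f = fits f ∧ supports f

  removable : (ℕ → ℕ) → ℕ → Bool
  removable f k = removable₀ (shift k f)

  opens : (ℕ → ℕ) → ℕ → Bool
  opens f zero    = true
  opens f (suc k) = supports (shift k f)

  insertable : (ℕ → ℕ) → ℕ → Bool
  insertable f k = opens f k ∧ fits (shift k f)

  cut paste : (ℕ → ℕ) → ℕ → ℕ → ℕ
  cut   f k = atRow k cut₀ f
  paste g k = atRow k paste₀ g

  removals : ℕ → ℕ
  removals n = sum (map (λ xs → Σ< (χ ∘ removable (part xs)) n) (partitions n))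

  record Laws : Set where
    field
      0<h                  : 0 < h
      fits-cong            : ∀ {f g} → f ≗ g → fits f ≡ fits g
      cut₀-cong            : ∀ {f g} → f ≗ g → cut₀ f ≗ cut₀ g
      paste₀-cong          : ∀ {f g} → f ≗ g → paste₀ f ≗ paste₀ g
      paste₀-head-positive : ∀ g → 0 < paste₀ g 0
      paste₀-head-antitone : ∀ {g} → Antitone g → paste₀ (g ∘ suc) 0 ≤ paste₀ g 0
      unfit⇒paste₀-head≤   : ∀ {g} → Antitone g → ¬ T (fits g) → paste₀ g 0 ≤ g 0
      cut₀-antitone        : ∀ {f} → Antitone f → T (removable₀ f) → Antitone (cut₀ f)
      cut₀-head            : ∀ {f} → Antitone f → T (removable₀ f) → cut₀ f 0 ≤ f 0
      cut₀-fits            : ∀ {f} → Antitone f → T (removable₀ f) → T (fits (cut₀ f))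
      cut₀-vanish          : ∀ {f N} → Antitone f → T (removable₀ f) → f N ≡ 0 → cut₀ f N ≡ 0
      cut₀-total           : ∀ {f N} → Antitone f → T (removable₀ f) → f N ≡ 0 → Σ< (cut₀ f) N + h ≡ Σ< f N
      paste₀-cut₀          : ∀ {f} → Antitone f → T (removable₀ f) → paste₀ (cut₀ f) ≗ f
      paste₀-antitone      : ∀ {g} → Antitone g → T (fits g) → Antitone (paste₀ g)
      paste₀-removable     : ∀ {g} → Antitone g → T (fits g) → T (removable₀ (paste₀ g))
      paste₀-vanish        : ∀ {g N} → Antitone g → g N ≡ 0 → paste₀ g (N + h) ≡ 0
      cut₀-paste₀          : ∀ g → cut₀ (paste₀ g) ≗ g

  module Consequences (laws : Laws) where
    open Laws laws

    supports-cong : ∀ {f g} → f ≗ g → supports f ≡ supports g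
    supports-cong eq = cong₂ _≤ᵇ_ (paste₀-cong (eq ∘ suc) 0) (eq 0)

    removable-cong : ∀ {f g} → f ≗ g → ∀ k → removable f k ≡ removable g k
    removable-cong eq k = cong₂ _∧_ (fits-cong (shift-cong k eq)) (supports-cong (shift-cong k eq))

    opens-cong : ∀ {f g} → f ≗ g → ∀ k → opens f k ≡ opens g k
    opens-cong eq zero    = refl
    opens-cong eq (suc k) = supports-cong (shift-cong k eq)

    insertable-cong : ∀ {f g} → f ≗ g → ∀ k → insertable f k ≡ insertable g k
    insertable-cong eq k = cong₂ _∧_ (opens-cong eq k) (fits-cong (shift-cong k eq))

    ¬supports-vanishing : ∀ {s} → s 0 ≡ 0 → ¬ T (supports s)
    ¬supports-vanishing {s} s0≡0 t =
      <⇒≱ (paste₀-head-positive (s ∘ suc)) (subst (paste₀ (s ∘ suc) 0 ≤_) s0≡0 (≤ᵇ⇒≤ _ _ t))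

    supports-unfit : ∀ {s} → Antitone s → ¬ T (fits s) → T (supports s)
    supports-unfit anti unfit = ≤⇒≤ᵇ (≤-trans (paste₀-head-antitone anti) (unfit⇒paste₀-head≤ anti unfit))

    ¬removable-vanishing : ∀ {f k} → f k ≡ 0 → ¬ T (removable f k)
    ¬removable-vanishing {f} {k} fk≡0 t =
      ¬supports-vanishing {shift k f} (trans (shift-head k f) fk≡0) (proj₂ (Equivalence.to T-∧ t))

    removable⇒< : ∀ {n f k} → IsPartitionFn n f → T (removable f k) → k < n
    removable⇒< {f = f} {k} pf t = ≰⇒> λ n≤k → ¬removable-vanishing {f} {k} (IsPartitionFn.vanishes-beyond pf n≤k) t

    insertable⇒≤ : ∀ {m g k} → IsPartitionFn m g → T (insertable g k) → k ≤ m
    insertable⇒≤ {k = zero}          pf t = z≤n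
    insertable⇒≤ {g = g} {k = suc k} pf t = ≰⇒> λ m≤k →
      ¬supports-vanishing {shift k g} (trans (shift-head k g) (vanishes-beyond m≤k)) (proj₁ (Equivalence.to T-∧ t))
      where open IsPartitionFn pf

    ¬opens-beyond : ∀ {m g K} → IsPartitionFn m g → m < K → ¬ T (opens g K)
    ¬opens-beyond {g = g} {suc K} pf (s≤s m≤K) =
      ¬supports-vanishing {shift K g} (trans (shift-head K g) (IsPartitionFn.vanishes-beyond pf m≤K))

    unfit⇒opens : ∀ {g} → Antitone g → ∀ k → ¬ T (fits (shift k g)) → T (opens g k) × T (opens g (suc k))
    unfit⇒opens     anti zero    unfit = tt , supports-unfit anti unfit
    unfit⇒opens {g} anti (suc k) unfit = opens-k , supports-unfit anti-s unfit
      where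
      anti-s = shift-antitone (suc k) anti
      opens-k : T (supports (shift k g))
      opens-k = ≤⇒≤ᵇ (begin
        paste₀ (shift k g ∘ suc) 0  ≡⟨ cong (λ s → paste₀ s 0) (shift-suc k g) ⟩
        paste₀ (shift (suc k) g) 0  ≤⟨ unfit⇒paste₀-head≤ anti-s unfit ⟩
        shift (suc k) g 0           ≡⟨ cong-app (sym (shift-suc k g)) 0 ⟩
        shift k g 1                 ≤⟨ shift-antitone k anti 0 ⟩
        shift k g 0                 ∎)
        where open ≤-Reasoning

    cut-antitone : ∀ {f} k → Antitone f → T (removable f k) → Antitone (cut f k)
    cut-antitone     zero    anti t = cut₀-antitone anti t
    cut-antitone {f} (suc k) anti t = atRow-antitone k cut₀ anti (cut₀-antitone anti-s t)
      (≤-trans (cut₀-head anti-s t) (subst (_≤ f k) (sym (shift-head (suc k) f)) (anti k)))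
      where anti-s = shift-antitone (suc k) anti

    paste-antitone : ∀ {g} k → Antitone g → T (insertable g k) → Antitone (paste g k)
    paste-antitone     zero    anti t = paste₀-antitone anti (proj₂ (Equivalence.to T-∧ t))
    paste-antitone {g} (suc k) anti t = atRow-antitone k paste₀ anti
      (paste₀-antitone (shift-antitone (suc k) anti) (proj₂ (Equivalence.to T-∧ t)))
      (subst₂ (λ s x → paste₀ s 0 ≤ x) (shift-suc k g) (shift-head k g) (≤ᵇ⇒≤ _ _ (proj₁ (Equivalence.to T-∧ t))))

    cut-total : ∀ {n f k} → IsPartitionFn n f → T (removable f k) → Σ< (cut f k) n + h ≡ n
    cut-total {f = f} {k} pf t with m≤n⇒∃[o]m+o≡n {k} (<⇒≤ (removable⇒< {f = f} {k} pf t))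
    ... | N , refl = begin
      Σ< (cut f k) (k + N) + h                 ≡⟨ cong (_+ h) (Σ<-atRow k cut₀ f N) ⟩
      Σ< f k + Σ< (cut₀ (shift k f)) N + h    ≡⟨ +-assoc (Σ< f k) _ h ⟩
      Σ< f k + (Σ< (cut₀ (shift k f)) N + h)  ≡⟨ cong (Σ< f k +_) (cut₀-total (shift-antitone k antitone) t
                                                                    (trans (shift-apply k f N) vanishes)) ⟩
      Σ< f k + Σ< (shift k f) N               ≡⟨ sym (Σ<-shift f k N) ⟩
      Σ< f (k + N)                             ≡⟨ total ⟩
      k + N                                    ∎
      where
      open IsPartitionFn pf
      open ≡-Reasoning

    removable-size : ∀ {n f k} → IsPartitionFn n f → T (removable f k) → h ≤ n
    removable-size {f = f} {k} pf t = subst (h ≤_) (cut-total {f = f} {k} pf t) (m≤n+m h _)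

    cut-isPartitionFn : ∀ {m f k} → IsPartitionFn (m + h) f → T (removable f k) → IsPartitionFn m (cut f k)
    cut-isPartitionFn {m} {f} {k} pf t with m≤n⇒∃[o]m+o≡n (<⇒≤ (removable⇒< {f = f} {k} pf t))
    ... | N , k+N≡m+h = isPartitionFn (cut-antitone k antitone t) vanish (+-cancelʳ-≡ h _ _ (cut-total {f = f} {k} pf t))
      where
      open IsPartitionFn pf
      vanish : cut f k (m + h) ≡ 0
      vanish = begin
        cut f k (m + h)        ≡⟨ cong (cut f k) (sym k+N≡m+h) ⟩
        cut f k (k + N)        ≡⟨ atRow-beyond k cut₀ f N ⟩
        cut₀ (shift k f) N     ≡⟨ cut₀-vanish (shift-antitone k antitone) t
                                    (trans (shift-apply k f N) (trans (cong f k+N≡m+h) vanishes)) ⟩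
        0                      ∎
        where open ≡-Reasoning

    cut-insertable : ∀ {f} k → Antitone f → T (removable f k) → T (insertable (cut f k) k)
    cut-insertable {f} k anti t = Equivalence.from T-∧ (opens-cut k t ,
      subst (T ∘ fits) (sym (shift-atRow k cut₀ f)) (cut₀-fits (shift-antitone k anti) t))
      where
      opens-cut : ∀ k → T (removable f k) → T (opens (cut f k) k)
      opens-cut zero    _ = tt
      opens-cut (suc k) t = ≤⇒≤ᵇ (begin
        paste₀ (shift k (cut f (suc k)) ∘ suc) 0  ≡⟨ cong (λ s → paste₀ s 0)
                                                      (trans (shift-suc k (cut f (suc k))) (shift-atRow k cut₀ (f ∘ suc))) ⟩
        paste₀ (cut₀ (shift (suc k) f)) 0         ≡⟨ paste₀-cut₀ (shift-antitone (suc k) anti) t 0 ⟩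
        shift (suc k) f 0                         ≡⟨ shift-head (suc k) f ⟩
        f (suc k)                                 ≤⟨ anti k ⟩
        f k                                       ≡⟨ sym (atRow-prefix (suc k) cut₀ f (n<1+n k)) ⟩
        cut f (suc k) k                           ≡⟨ sym (shift-head k (cut f (suc k))) ⟩
        shift k (cut f (suc k)) 0                 ∎)
        where open ≤-Reasoning

    paste-cut : ∀ {f} k → Antitone f → T (removable f k) → paste (cut f k) k ≗ f
    paste-cut {f} k anti t = atRow-inverse k cut₀ paste₀ f (paste₀-cut₀ (shift-antitone k anti) t)

    paste-isPartitionFn : ∀ {m g k} → IsPartitionFn m g → T (insertable g k) → IsPartitionFn (m + h) (paste g k)
    paste-isPartitionFn {g = g} {k} pg t with m≤n⇒∃[o]m+o≡n {k} (insertable⇒≤ pg t)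
    ... | M , refl = isPartitionFn (paste-antitone k antitone t) vanish total′
      where
      open IsPartitionFn pg
      s = shift k g
      anti-s : Antitone s
      anti-s = shift-antitone k antitone
      fits-s : T (fits s)
      fits-s = proj₂ (Equivalence.to T-∧ t)
      paste₀-vanishes : paste₀ s (M + h) ≡ 0
      paste₀-vanishes = paste₀-vanish anti-s (trans (shift-apply k g M) vanishes)
      vanish : paste g k (k + (M + h)) ≡ 0
      vanish = trans (atRow-beyond k paste₀ g (M + h)) paste₀-vanishes
      total′ : Σ< (paste g k) (k + (M + h)) ≡ k + M + h
      total′ = begin
        Σ< (paste g k) (k + (M + h))
          ≡⟨ Σ<-atRow k paste₀ g (M + h) ⟩
        Σ< g k + Σ< (paste₀ s) (M + h)
          ≡⟨ cong (Σ< g k +_) (sym (cut₀-total (paste₀-antitone anti-s fits-s) (paste₀-removable anti-s fits-s)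
                                               paste₀-vanishes)) ⟩
        Σ< g k + (Σ< (cut₀ (paste₀ s)) (M + h) + h)
          ≡⟨ cong (λ x → Σ< g k + (x + h)) (Σ<-cong (M + h) (λ j _ → cut₀-paste₀ s j)) ⟩
        Σ< g k + (Σ< s (M + h) + h)
          ≡⟨ sym (+-assoc (Σ< g k) _ h) ⟩
        Σ< g k + Σ< s (M + h) + h
          ≡⟨ cong (_+ h) (sym (Σ<-shift g k (M + h))) ⟩
        Σ< g (k + (M + h)) + h
          ≡⟨ cong (_+ h) (Σ<-tail-zero (+-monoʳ-≤ k (m≤m+n M h)) (λ _ → vanishes-beyond)) ⟩
        Σ< g (k + M) + h
          ≡⟨ cong (_+ h) total ⟩
        k + M + h
          ∎
        where open ≡-Reasoning

    paste-removable : ∀ {g} k → Antitone g → T (insertable g k) → T (removable (paste g k) k)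
    paste-removable {g} k anti t = subst (T ∘ removable₀) (sym (shift-atRow k paste₀ g))
      (paste₀-removable (shift-antitone k anti) (proj₂ (Equivalence.to T-∧ t)))

    cut-paste : ∀ g k → cut (paste g k) k ≗ g
    cut-paste g k = atRow-inverse k paste₀ cut₀ g (cut₀-paste₀ (shift k g))

    Σ<-insertable : ∀ {m g} → IsPartitionFn m g → Σ< (χ ∘ insertable g) (m + h) ≡ Σ< (χ ∘ removable g) m + 1
    Σ<-insertable {m} {g} pg = begin
      Σ< (χ ∘ insertable g) (m + h)                        ≡⟨ sym (+-identityʳ _) ⟩
      Σ< (χ ∘ insertable g) (m + h) + 0                    ≡⟨ cong (Σ< (χ ∘ insertable g) (m + h) +_)
                                                                (sym (χ-false (¬opens-beyond pg (m<m+n m 0<h)))) ⟩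
      Σ< (χ ∘ insertable g) (m + h) + χ (opens g (m + h))  ≡⟨ telescope (opens g) (λ k → fits (shift k g))
                                                                (unfit⇒opens (IsPartitionFn.antitone pg)) (m + h) ⟩
      Σ< (χ ∘ removable g) (m + h) + 1                     ≡⟨ cong (_+ 1) (Σ<-tail-zero (m≤m+n m h)
                                                                (λ j m≤j → χ-false (λ t → <⇒≱ (removable⇒< pg t) m≤j))) ⟩
      Σ< (χ ∘ removable g) m + 1                           ∎
      where open ≡-Reasoning

    removals-below : ∀ {n} → n < h → removals n ≡ 0
    removals-below {n} n<h = sum-map-zero (partitions n) λ {xs} xs∈ →
      Σ<-zero n (λ j → χ-false (λ t → <⇒≱ n<h (removable-size {k = j} (IsPartition⇒IsPartitionFn (∈-partitions⁻ xs∈))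
                                                                    t)))

    removal-positions insertion-positions : ℕ → List (List ℕ × ℕ)
    removal-positions   n = positions (partitions n) (removable ∘ part) n
    insertion-positions m = positions (partitions m) (insertable ∘ part) (m + h)

    removal↔insertion : ∀ m → length (removal-positions (m + h)) ≡ length (insertion-positions m)
    removal↔insertion m =
      length-inverse (positions-unique (removable ∘ part) (m + h) (partitions-unique (m + h)))
                     (positions-unique (insertable ∘ part) (m + h) (partitions-unique m))
        F G F∈ G∈ GF FG
      where
      F G : List ℕ × ℕ → List ℕ × ℕ
      F (xs , k) = partList (cut (part xs) k) m , k
      G (ys , k) = partList (paste (part ys) k) (m + h) , k

      removal : ∀ {xs k} → (xs , k) ∈ removal-positions (m + h) →
        IsPartition (m + h) xs × k < m + h × T (removable (part xs) k)
      removal p∈ with ∈-positions⁻ p∈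
      ... | xs∈ , k< , t = ∈-partitions⁻ xs∈ , k< , t

      insertion : ∀ {ys k} → (ys , k) ∈ insertion-positions m →
        IsPartition m ys × k < m + h × T (insertable (part ys) k)
      insertion p∈ with ∈-positions⁻ p∈
      ... | ys∈ , k< , t = ∈-partitions⁻ ys∈ , k< , t

      F∈ : ∀ {p} → p ∈ removal-positions (m + h) → F p ∈ insertion-positions m
      F∈ {xs , k} p∈ with removal p∈
      ... | isP , k< , t = ∈-positions⁺ (∈-partitions⁺ (IsPartitionFn⇒IsPartition pg)) k<
        (subst T (sym (insertable-cong (part-partList m antitone vanishes) k))
                 (cut-insertable k (IsPartitionFn.antitone pf) t))
        where
        pf = IsPartition⇒IsPartitionFn isP
        pg = cut-isPartitionFn {k = k} pf t
        open IsPartitionFn pg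

      G∈ : ∀ {p} → p ∈ insertion-positions m → G p ∈ removal-positions (m + h)
      G∈ {ys , k} p∈ with insertion p∈
      ... | isP , k< , t = ∈-positions⁺ (∈-partitions⁺ (IsPartitionFn⇒IsPartition pf)) k<
        (subst T (sym (removable-cong (part-partList (m + h) antitone vanishes) k))
                 (paste-removable k (IsPartitionFn.antitone pg) t))
        where
        pg = IsPartition⇒IsPartitionFn isP
        pf = paste-isPartitionFn {k = k} pg t
        open IsPartitionFn pf

      GF : ∀ {p} → p ∈ removal-positions (m + h) → G (F p) ≡ p
      GF {xs , k} p∈ = cong (_, k) (partList-part isP (paste-isPartitionFn {k = k} pg u) λ j →
        trans (atRow-cong k paste₀ paste₀-cong (part-partList m antitone vanishes) j)
              (paste-cut k (IsPartitionFn.antitone pf) t j))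
        where
        isP = proj₁ (removal p∈)
        t   = proj₂ (proj₂ (removal p∈))
        pf  = IsPartition⇒IsPartitionFn isP
        pg  = IsPartition⇒IsPartitionFn (proj₁ (insertion (F∈ p∈)))
        u   = proj₂ (proj₂ (insertion (F∈ p∈)))
        open IsPartitionFn (cut-isPartitionFn {k = k} pf t)

      FG : ∀ {p} → p ∈ insertion-positions m → F (G p) ≡ p
      FG {ys , k} p∈ = cong (_, k) (partList-part isP (cut-isPartitionFn {k = k} pf t) λ j →
        trans (atRow-cong k cut₀ cut₀-cong (part-partList (m + h) antitone vanishes) j)
              (cut-paste (part ys) k j))
        where
        isP = proj₁ (insertion p∈)
        u   = proj₂ (proj₂ (insertion p∈))
        pf  = IsPartition⇒IsPartitionFn (proj₁ (removal (G∈ p∈)))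
        t   = proj₂ (proj₂ (removal (G∈ p∈)))
        open IsPartitionFn (paste-isPartitionFn {k = k} (IsPartition⇒IsPartitionFn isP) u)

    removals-step : ∀ m → removals (m + h) ≡ removals m + length (partitions m)
    removals-step m = begin
      removals (m + h)
        ≡⟨ sym (length-positions (partitions (m + h)) (removable ∘ part) (m + h)) ⟩
      length (removal-positions (m + h))
        ≡⟨ removal↔insertion m ⟩
      length (insertion-positions m)
        ≡⟨ length-positions (partitions m) (insertable ∘ part) (m + h) ⟩
      sum (map (λ ys → Σ< (χ ∘ insertable (part ys)) (m + h)) (partitions m))
        ≡⟨ sum-map-cong (partitions m) (λ ys∈ → Σ<-insertable {m} (IsPartition⇒IsPartitionFn (∈-partitions⁻ ys∈))) ⟩
      sum (map (λ ys → Σ< (χ ∘ removable (part ys)) m + 1) (partitions m))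
        ≡⟨ sum-map-+1 (λ ys → Σ< (χ ∘ removable (part ys)) m) (partitions m) ⟩
      removals m + length (partitions m)
        ∎
      where open ≡-Reasoning

-- Removing a part of size h: row k, of length h, is deleted.
module RowSurgery (h : ℕ) = Surgery h (λ g → g 0 ≤ᵇ h) (_∘ suc) (h ◂_)

rowSurgery-laws : ∀ h′ → RowSurgery.Laws (suc h′)
rowSurgery-laws h′ = record
  { 0<h                  = z<s
  ; fits-cong            = λ eq → cong (_≤ᵇ h) (eq 0)
  ; cut₀-cong            = λ eq → eq ∘ suc
  ; paste₀-cong          = λ { eq zero → refl ; eq (suc m) → eq m }
  ; paste₀-head-positive = λ _ → z<s
  ; paste₀-head-antitone = λ _ → ≤-refl
  ; unfit⇒paste₀-head≤   = λ _ unfit → <⇒≤ (≰⇒> (unfit ∘ ≤⇒≤ᵇ))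
  ; cut₀-antitone        = λ anti _ → anti ∘ suc
  ; cut₀-head            = λ anti _ → anti 0
  ; cut₀-fits            = λ anti t → ≤⇒≤ᵇ (≤-trans (anti 0) (≤ᵇ⇒≤ _ h (proj₁ (Equivalence.to T-∧ t))))
  ; cut₀-vanish          = λ anti _ fN≡0 → antitone-vanish anti fN≡0 (n≤1+n _)
  ; cut₀-total           = total
  ; paste₀-cut₀          = λ {f} anti t → λ { zero → sym (f0≡h {f} t) ; (suc m) → refl }
  ; paste₀-antitone      = λ anti fits → ◂-antitone (≤ᵇ⇒≤ _ h fits) anti
  ; paste₀-removable     = λ _ _ → Equivalence.from (T-∧ {h ≤ᵇ h} {h ≤ᵇ h})
                                                    (≤⇒≤ᵇ (≤-refl {h}) , ≤⇒≤ᵇ (≤-refl {h}))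
  ; paste₀-vanish        = vanish
  ; cut₀-paste₀          = λ _ _ → refl
  }
  where
  h = suc h′
  open RowSurgery h using (removable₀)

  f0≡h : ∀ {f} → T (removable₀ f) → f 0 ≡ h
  f0≡h t = ≤-antisym (≤ᵇ⇒≤ _ h (proj₁ (Equivalence.to T-∧ t))) (≤ᵇ⇒≤ h _ (proj₂ (Equivalence.to T-∧ t)))

  total : ∀ {f N} → Antitone f → T (removable₀ f) → f N ≡ 0 → Σ< (f ∘ suc) N + h ≡ Σ< f N
  total {f} {N} anti t fN≡0 = begin
    Σ< (f ∘ suc) N + h     ≡⟨ +-comm _ h ⟩
    h + Σ< (f ∘ suc) N     ≡⟨ cong (_+ Σ< (f ∘ suc) N) (sym (f0≡h {f} t)) ⟩
    Σ< f (suc N)           ≡⟨ Σ<-tail-zero (n≤1+n N) (λ _ → antitone-vanish anti fN≡0) ⟩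
    Σ< f N                 ∎
    where open ≡-Reasoning

  vanish : ∀ {g N} → Antitone g → g N ≡ 0 → (h ◂ g) (N + h) ≡ 0
  vanish {g} {N} anti gN≡0 = trans (cong (h ◂ g) (+-suc N h′)) (antitone-vanish anti gN≡0 (m≤m+n N h′))

-- lower e j f: rows 1, …, j of f move up one row, losing a cell each, and row j becomes e.
lower : ℕ → ℕ → (ℕ → ℕ) → ℕ → ℕ
lower e zero    f = e ◂ (f ∘ suc)
lower e (suc j) f = pred (f 1) ◂ lower e j (f ∘ suc)

-- raise x j g: rows 0, …, j-1 of g move down one row, gaining a cell each, and row 0 becomes x.
raise : ℕ → ℕ → (ℕ → ℕ) → ℕ → ℕ
raise x zero    g = x ◂ (g ∘ suc)
raise x (suc j) g = x ◂ raise (suc (g 0)) j (g ∘ suc)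

lower-cong : ∀ e j {f f′} → f ≗ f′ → lower e j f ≗ lower e j f′
lower-cong e zero    eq zero    = refl
lower-cong e zero    eq (suc m) = eq (suc m)
lower-cong e (suc j) eq zero    = cong pred (eq 1)
lower-cong e (suc j) eq (suc m) = lower-cong e j (eq ∘ suc) m

raise-cong : ∀ x j {g g′} → g ≗ g′ → raise x j g ≗ raise x j g′
raise-cong x zero            eq zero    = refl
raise-cong x zero            eq (suc m) = eq (suc m)
raise-cong x (suc j)         eq zero    = refl
raise-cong x (suc j) {g} {g′} eq (suc m) =
  trans (cong (λ y → raise (suc y) j (g ∘ suc) m) (eq 0)) (raise-cong (suc (g′ 0)) j (eq ∘ suc) m)

lower-at : ∀ e j f → lower e j f j ≡ e
lower-at e zero    f = refl
lower-at e (suc j) f = lower-at e j (f ∘ suc)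

lower-beyond : ∀ e j f {m} → j < m → lower e j f m ≡ f m
lower-beyond e zero    f {suc m} _   = refl
lower-beyond e (suc j) f {suc m} j<m = lower-beyond e j (f ∘ suc) (s<s⁻¹ j<m)

raise-head : ∀ x j g → raise x j g 0 ≡ x
raise-head x zero    g = refl
raise-head x (suc j) g = refl

raise-last : ∀ x j g → raise x (suc j) g (suc j) ≡ suc (g j)
raise-last x zero    g = refl
raise-last x (suc j) g = raise-last (suc (g 0)) j (g ∘ suc)

raise-beyond : ∀ x j g {m} → j < m → raise x j g m ≡ g m
raise-beyond x zero    g {suc m} _   = refl
raise-beyond x (suc j) g {suc m} j<m = raise-beyond (suc (g 0)) j (g ∘ suc) (s<s⁻¹ j<m)

lower-antitone : ∀ e j {f} → Antitone f → f (suc j) ≤ e → e < f j → Antitone (lower e j f)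
lower-antitone e zero    anti below above = ◂-antitone below (anti ∘ suc)
lower-antitone e (suc j) {f} anti below above =
  ◂-antitone (head j above) (lower-antitone e j (anti ∘ suc) below above)
  where
  head : ∀ j → e < f (suc j) → lower e j (f ∘ suc) 0 ≤ pred (f 1)
  head zero    e<f1 = <⇒≤pred e<f1
  head (suc j) _    = pred-mono-≤ (anti 1)

lower-head-≤ : ∀ e j {f a} → Antitone f → e ≤ a → pred (f 0) ≤ a → lower e j f 0 ≤ a
lower-head-≤ e zero    anti e≤a f0-1≤a = e≤a
lower-head-≤ e (suc j) anti e≤a f0-1≤a = ≤-trans (pred-mono-≤ (anti 0)) f0-1≤a

raise-at : ∀ x j {g} → Antitone g → suc (g j) ≤ x → suc (g j) ≤ raise x j g j
raise-at x zero    anti gj<x = gj<x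
raise-at x (suc j) {g} anti gj<x = subst (suc (g (suc j)) ≤_) (sym (raise-last x j g)) (s≤s (anti j))

raise-antitone : ∀ x j {g} → Antitone g → g 0 < x → Antitone (raise x j g)
raise-antitone x zero    anti g0<x = ◂-antitone (≤-trans (anti 0) (<⇒≤ g0<x)) (anti ∘ suc)
raise-antitone x (suc j) {g} anti g0<x =
  ◂-antitone (subst (_≤ x) (sym (raise-head (suc (g 0)) j (g ∘ suc))) g0<x)
             (raise-antitone (suc (g 0)) j (anti ∘ suc) (s≤s (anti 0)))

lower-raise : ∀ x j g → lower (g j) j (raise x j g) ≗ g
lower-raise x zero    g zero    = refl
lower-raise x zero    g (suc m) = refl
lower-raise x (suc j) g zero    = cong pred (raise-head (suc (g 0)) j (g ∘ suc))
lower-raise x (suc j) g (suc m) = lower-raise (suc (g 0)) j (g ∘ suc) m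

raise-lower : ∀ e j {f} → (∀ m → m < j → 0 < f (suc m)) → raise (f 0) j (lower e j f) ≗ f
raise-lower e zero        pos zero    = refl
raise-lower e zero        pos (suc m) = refl
raise-lower e (suc j)     pos zero    = refl
raise-lower e (suc j) {f} pos (suc m) =
  trans (cong (λ y → raise y j (lower e j (f ∘ suc)) m) (suc-pred (f 1) {{>-nonZero (pos 0 z<s)}}))
        (raise-lower e j (λ m′ m′<j → pos (suc m′) (s<s m′<j)) m)

lower-total : ∀ e j {f} M → (∀ m → m < j → 0 < f (suc m)) →
  Σ< (lower e j f) (suc j + M) + (j + f 0) ≡ Σ< f (suc j + M) + e
lower-total e zero    {f} M pos = shuffle e (Σ< (f ∘ suc) M) (f 0)
  where
  shuffle : ∀ a b c → a + b + c ≡ c + b + a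
  shuffle = solve-∀
lower-total e (suc j) {f} M pos = begin
  pred (f 1) + S + (suc j + f 0)       ≡⟨ shuffle (pred (f 1)) S j (f 0) ⟩
  f 0 + (S + (j + suc (pred (f 1))))   ≡⟨ cong (λ y → f 0 + (S + (j + y))) (suc-pred (f 1) {{>-nonZero (pos 0 z<s)}}) ⟩
  f 0 + (S + (j + f 1))                ≡⟨ cong (f 0 +_) (lower-total e j M (λ m m<j → pos (suc m) (s<s m<j))) ⟩
  f 0 + (Σ< (f ∘ suc) (suc j + M) + e) ≡⟨ sym (+-assoc (f 0) _ e) ⟩
  f 0 + Σ< (f ∘ suc) (suc j + M) + e   ∎
  where
  open ≡-Reasoning
  S = Σ< (lower e j (f ∘ suc)) (suc j + M)
  shuffle : ∀ p s j a → p + s + (suc j + a) ≡ a + (s + (j + suc p))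
  shuffle = solve-∀

-- Removing a rim hook with arm c and leg d whose corner lies in row k.
module HookSurgery (c d : ℕ) =
  Surgery (suc (c + d)) (λ g → g 0 ≤ᵇ g d + c) (λ f → lower (f 0 ∸ suc c) d f) (λ g → raise (g d + suc c) d g)

module _ (c d : ℕ) where
  open HookSurgery c d using (removable₀)

  removable₀⇒hook : ∀ {f} → T (removable₀ f) → f 0 ≤ f d + c × f (suc d) + suc c ≤ f 0
  removable₀⇒hook {f} t with Equivalence.to T-∧ t
  ... | fits , supports = ≤ᵇ⇒≤ _ _ fits ,
    subst (_≤ f 0) (raise-head (f (suc d) + suc c) d (f ∘ suc)) (≤ᵇ⇒≤ _ _ supports)

  hook⇒removable₀ : ∀ {f} → f 0 ≤ f d + c → f (suc d) + suc c ≤ f 0 → T (removable₀ f)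
  hook⇒removable₀ {f} fits supports = Equivalence.from T-∧ (≤⇒≤ᵇ fits ,
    ≤⇒≤ᵇ (subst (_≤ f 0) (sym (raise-head (f (suc d) + suc c) d (f ∘ suc))) supports))

  module RemovableHook (f : ℕ → ℕ) (anti : Antitone f) (t : T (removable₀ f)) where
    e : ℕ
    e = f 0 ∸ suc c

    fits : f 0 ≤ f d + c
    fits = proj₁ (removable₀⇒hook {f} t)

    supports : f (suc d) + suc c ≤ f 0
    supports = proj₂ (removable₀⇒hook {f} t)

    e+1+c≡f0 : e + suc c ≡ f 0
    e+1+c≡f0 = m∸n+n≡m (≤-trans (m≤n+m (suc c) (f (suc d))) supports)

    fd+1+c≤e+1+c : f (suc d) + suc c ≤ e + suc c
    fd+1+c≤e+1+c = subst (f (suc d) + suc c ≤_) (sym e+1+c≡f0) supports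

    e<fd : e < f d
    e<fd = +-cancelʳ-< c e (f d) (begin-strict
      e + c         <⟨ n<1+n (e + c) ⟩
      suc (e + c)   ≡⟨ sym (+-suc e c) ⟩
      e + suc c     ≡⟨ e+1+c≡f0 ⟩
      f 0           ≤⟨ fits ⟩
      f d + c       ∎)
      where open ≤-Reasoning

    rows-positive : ∀ m → m < d → 0 < f (suc m)
    rows-positive m m<d = <-≤-trans (≤-<-trans z≤n e<fd) (antitone-mono anti m<d)

    d<N : ∀ {N} → f N ≡ 0 → d < N
    d<N fN≡0 = ≰⇒> λ N≤d → <⇒≢ (≤-<-trans z≤n e<fd) (sym (antitone-vanish anti fN≡0 N≤d))

  hookSurgery-laws : HookSurgery.Laws c d
  hookSurgery-laws = record
    { 0<h                  = z<s
    ; fits-cong            = λ eq → cong₂ (λ a b → a ≤ᵇ b + c) (eq 0) (eq d)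
    ; cut₀-cong            = λ {f} {g} eq m → trans (cong (λ y → lower (y ∸ suc c) d f m) (eq 0))
                                                      (lower-cong (g 0 ∸ suc c) d eq m)
    ; paste₀-cong          = λ {f} {g} eq m → trans (cong (λ y → raise (y + suc c) d f m) (eq d))
                                                      (raise-cong (g d + suc c) d eq m)
    ; paste₀-head-positive = λ g → subst (0 <_) (sym (raise-head (g d + suc c) d g))
                                         (≤-trans (s≤s z≤n) (m≤n+m (suc c) (g d)))
    ; paste₀-head-antitone = λ {g} anti → subst₂ _≤_ (sym (raise-head _ d (g ∘ suc))) (sym (raise-head _ d g))
                                                    (+-monoˡ-≤ (suc c) (anti d))
    ; unfit⇒paste₀-head≤   = λ {g} anti unfit → subst₂ _≤_ (trans (sym (+-suc (g d) c)) (sym (raise-head _ d g))) refl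
                                                    (≰⇒> (unfit ∘ ≤⇒≤ᵇ))
    ; cut₀-antitone        = λ {f} anti t → let open RemovableHook f anti t in
                               lower-antitone e d anti (+-cancelʳ-≤ (suc c) (f (suc d)) e fd+1+c≤e+1+c) e<fd
    ; cut₀-head            = λ {f} anti t → let open RemovableHook f anti t in
                               lower-head-≤ e d anti (m∸n≤m (f 0) (suc c)) pred[n]≤n
    ; cut₀-fits            = cut-fits
    ; cut₀-vanish          = λ {f} anti t fN≡0 → let open RemovableHook f anti t in
                               trans (lower-beyond e d f (d<N fN≡0)) fN≡0
    ; cut₀-total           = cut-total
    ; paste₀-cut₀          = λ {f} anti t m → let open RemovableHook f anti t in
                               trans (cong (λ y → raise y d (lower e d f) m)
                                           (trans (cong (_+ suc c) (lower-at e d f)) e+1+c≡f0))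
                                     (raise-lower e d rows-positive m)
    ; paste₀-antitone      = λ {g} anti fits → raise-antitone _ d anti
                               (subst (g 0 <_) (sym (+-suc (g d) c)) (s≤s (≤ᵇ⇒≤ _ _ fits)))
    ; paste₀-removable     = paste-removable
    ; paste₀-vanish        = λ {g} {N} anti gN≡0 → trans (raise-beyond _ d g (≤-trans (s≤s (m≤n+m d c)) (m≤n+m _ N)))
                                                        (antitone-vanish anti gN≡0 (m≤m+n N _))
    ; cut₀-paste₀          = λ g m → let R = raise (g d + suc c) d g in
                               trans (cong (λ y → lower (y ∸ suc c) d R m) (raise-head _ d g))
                                     (trans (cong (λ y → lower y d R m) (m+n∸n≡m (g d) (suc c)))
                                            (lower-raise _ d g m))
    }
    where
    cut-fits : ∀ {f} → Antitone f → T (removable₀ f) →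
      T (lower (f 0 ∸ suc c) d f 0 ≤ᵇ lower (f 0 ∸ suc c) d f d + c)
    cut-fits {f} anti t = ≤⇒≤ᵇ (subst (λ y → lower e d f 0 ≤ y + c) (sym (lower-at e d f))
      (lower-head-≤ e d anti (m≤m+n e c) (≤-reflexive (cong pred (trans (sym e+1+c≡f0) (+-suc e c))))))
      where open RemovableHook f anti t

    cut-total : ∀ {f N} → Antitone f → T (removable₀ f) → f N ≡ 0 →
      Σ< (lower (f 0 ∸ suc c) d f) N + suc (c + d) ≡ Σ< f N
    cut-total {f} {N} anti t fN≡0 with m≤n⇒∃[o]m+o≡n (RemovableHook.d<N f anti t fN≡0)
    ... | M , refl = +-cancelʳ-≡ e _ _ (begin
      Σ< L (suc d + M) + suc (c + d) + e        ≡⟨ shuffle (Σ< L (suc d + M)) c d e ⟩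
      Σ< L (suc d + M) + (d + (e + suc c))      ≡⟨ cong (λ y → Σ< L (suc d + M) + (d + y)) e+1+c≡f0 ⟩
      Σ< L (suc d + M) + (d + f 0)              ≡⟨ lower-total e d M rows-positive ⟩
      Σ< f (suc d + M) + e                      ∎)
      where
      open RemovableHook f anti t
      open ≡-Reasoning
      L = lower e d f
      shuffle : ∀ s c d e → s + suc (c + d) + e ≡ s + (d + (e + suc c))
      shuffle = solve-∀

    paste-removable : ∀ {g} → Antitone g → T (g 0 ≤ᵇ g d + c) → T (removable₀ (raise (g d + suc c) d g))
    paste-removable {g} anti fits = hook⇒removable₀ {raise (g d + suc c) d g}
      (begin
        R 0                 ≡⟨ raise-head _ d g ⟩
        g d + suc c         ≡⟨ +-suc (g d) c ⟩
        suc (g d) + c       ≤⟨ +-monoˡ-≤ c (raise-at _ d anti (subst (suc (g d) ≤_) (sym (+-suc (g d) c))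
                                                                           (s≤s (m≤m+n (g d) c)))) ⟩
        R d + c             ∎)
      (begin
        R (suc d) + suc c   ≡⟨ cong (_+ suc c) (raise-beyond _ d g (n<1+n d)) ⟩
        g (suc d) + suc c   ≤⟨ +-monoˡ-≤ (suc c) (anti d) ⟩
        g d + suc c         ≡⟨ sym (raise-head _ d g) ⟩
        R 0                 ∎)
      where
      open ≤-Reasoning
      R = raise (g d + suc c) d g

χ-pair : ℕ → ℕ → ℕ × ℕ → ℕ
χ-pair c d (x , y) = χ ((x ≡ᵇ c) ∧ (y ≡ᵇ d))

count-as-sum : ∀ c d xs → count (c , d) xs ≡ sum (map (χ-pair c d) xs)
count-as-sum c d []             = refl
count-as-sum c d ((x , y) ∷ xs) with (x ≡ᵇ c) ∧ (y ≡ᵇ d)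
... | true  = cong suc (count-as-sum c d xs)
... | false = count-as-sum c d xs

sum-cellsFrom : ∀ (ψ : ℕ × ℕ → ℕ) i xs →
  sum (map ψ (cellsFrom (suc i) xs)) ≡ Σ< (λ m → Σ< (λ j → ψ (suc (i + m) , suc j)) (part xs m)) (length xs)
sum-cellsFrom ψ i []       = refl
sum-cellsFrom ψ i (p ∷ xs) = begin
  sum (map ψ (applyUpTo (λ j → (suc i , suc j)) p ++ cellsFrom (suc (suc i)) xs))
    ≡⟨ sum-map-++ ψ (applyUpTo (λ j → (suc i , suc j)) p) _ ⟩
  sum (map ψ (applyUpTo (λ j → (suc i , suc j)) p)) + sum (map ψ (cellsFrom (suc (suc i)) xs))
    ≡⟨ cong₂ _+_ (trans (sum-map-applyUpTo ψ _ p)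
                        (Σ<-cong p (λ j _ → cong (λ r → ψ (suc r , suc j)) (sym (+-identityʳ i)))))
                 (trans (sum-cellsFrom ψ (suc i) xs)
                        (Σ<-cong (length xs) (λ m _ → cong (λ r → Σ< (λ j → ψ (suc r , suc j)) (part xs m))
                                                          (sym (+-suc i m))))) ⟩
  Σ< (λ j → ψ (suc (i + 0) , suc j)) p + Σ< (λ m → Σ< (λ j → ψ (suc (i + suc m) , suc j)) (part xs m)) (length xs)
    ∎
  where open ≡-Reasoning

-- Within a row of length p, only the cell in column p - c has arm c.
Σ<-arm : ∀ c (Q : ℕ → Bool) p → Σ< (λ j → χ ((p ∸ suc j ≡ᵇ c) ∧ Q (suc j))) p ≡ χ ((c <ᵇ p) ∧ Q (p ∸ c))
Σ<-arm c Q zero    = refl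
Σ<-arm c Q (suc p) = trans (cong (χ ((p ≡ᵇ c) ∧ Q 1) +_) (Σ<-arm c (Q ∘ suc) p)) (first-or-rest (<-cmp c p))
  where
  first-or-rest : Tri (c < p) (c ≡ p) (p < c) →
    χ ((p ≡ᵇ c) ∧ Q 1) + χ ((c <ᵇ p) ∧ Q (suc (p ∸ c))) ≡ χ ((c <ᵇ suc p) ∧ Q (suc p ∸ c))
  first-or-rest (tri< c<p c≢p _)
    rewrite ¬T⇒≡false (c≢p ∘ sym ∘ ≡ᵇ⇒≡ p c) | T⇒≡true (<⇒<ᵇ c<p) | T⇒≡true (<⇒<ᵇ (m<n⇒m<1+n c<p))
          | +-∸-assoc 1 (<⇒≤ c<p) = refl
  first-or-rest (tri≈ _ refl _)
    rewrite T⇒≡true (≡⇒≡ᵇ c c refl) | ¬T⇒≡false (<-irrefl refl ∘ <ᵇ⇒< c c) | T⇒≡true (<⇒<ᵇ (n<1+n c))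
          | m+n∸n≡m 1 c = +-identityʳ _
  first-or-rest (tri> _ c≢p p<c)
    rewrite ¬T⇒≡false (c≢p ∘ sym ∘ ≡ᵇ⇒≡ p c) | ¬T⇒≡false (<⇒≱ p<c ∘ <⇒≤ ∘ <ᵇ⇒< c p)
          | ¬T⇒≡false (<⇒≱ p<c ∘ s≤s⁻¹ ∘ <ᵇ⇒< c (suc p)) = refl

≤part⇒<conjPart : ∀ {xs} → Linked _≥_ xs → ∀ {m j} → 1 ≤ j → j ≤ part xs m → m < conjPart xs j
≤part⇒<conjPart {[]}     _ 1≤j j≤0 = ⊥-elim (<⇒≱ 1≤j j≤0)
≤part⇒<conjPart {p ∷ ps} l {m} {j} 1≤j j≤part with j ≤ᵇ p in j≤ᵇp | m
... | true  | zero   = z<s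
... | true  | suc m′ = s<s (≤part⇒<conjPart (Linked.tail l) 1≤j j≤part)
... | false | m′     = ⊥-elim (subst T j≤ᵇp (≤⇒≤ᵇ (≤-trans j≤part
                                                          (antitone-mono (linked⇒antitone l) (z≤n {m′})))))

<conjPart⇒≤part : ∀ {xs} → Linked _≥_ xs → ∀ {m j} → m < conjPart xs j → j ≤ part xs m
<conjPart⇒≤part {p ∷ ps} l {m} {j} m<λ′j with j ≤ᵇ p in j≤ᵇp | m
... | true  | zero   = ≤ᵇ⇒≤ j p (subst T (sym j≤ᵇp) tt)
... | true  | suc m′ = <conjPart⇒≤part (Linked.tail l) (s<s⁻¹ m<λ′j)
... | false | m′     = ⊥-elim (subst T j≤ᵇp (≤⇒≤ᵇ (≤-trans (<conjPart⇒≤part (Linked.tail l) m<λ′j)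
                                                          (antitone-mono (linked⇒antitone l) (z≤n {suc m′})))))

module _ (c d : ℕ) where
  open HookSurgery c d using (removable)

  removable⇒hook : ∀ {f k} → T (removable f k) → f k ≤ f (k + d) + c × f (k + suc d) + suc c ≤ f k
  removable⇒hook {f} {k} t with removable₀⇒hook c d {shift k f} t
  ... | fits , supports =
    subst₂ (λ x y → x ≤ y + c) (shift-head k f) (shift-apply k f d) fits ,
    subst₂ (λ x y → x + suc c ≤ y) (shift-apply k f (suc d)) (shift-head k f) supports

  hook⇒removable : ∀ {f k} → f k ≤ f (k + d) + c → f (k + suc d) + suc c ≤ f k → T (removable f k)
  hook⇒removable {f} {k} fits supports = hook⇒removable₀ c d {shift k f}
    (subst₂ (λ x y → x ≤ y + c) (sym (shift-head k f)) (sym (shift-apply k f d)) fits)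
    (subst₂ (λ x y → x + suc c ≤ y) (sym (shift-apply k f (suc d))) (sym (shift-head k f)) supports)

  -- The cell of row m with arm c has leg d exactly when row m is the corner row of a removable hook.
  hook-cell : ∀ {xs} → Linked _≥_ xs → ∀ m →
    (c <ᵇ part xs m) ∧ (conjPart xs (part xs m ∸ c) ∸ suc m ≡ᵇ d) ≡ removable (part xs) m
  hook-cell {xs} l m = T-ext to from
    where
    f = part xs
    p = f m
    j = p ∸ c
    λ′j = conjPart xs j

    to : T ((c <ᵇ p) ∧ (λ′j ∸ suc m ≡ᵇ d)) → T (removable f m)
    to t = hook⇒removable {f} {m}
      (j≤⇒p≤ (<conjPart⇒≤part l (subst (m + d <_) (sym λ′j≡) (n<1+n (m + d)))))
      (subst (_≤ p) (sym (+-suc (f (m + suc d)) c)) (m≤o∸n⇒m+n≤o (suc (f (m + suc d))) (<⇒≤ c<p)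
        (≰⇒> λ j≤ → <-irrefl (trans (+-suc m d) (sym λ′j≡))
                             (≤part⇒<conjPart l (m<n⇒0<n∸m c<p) j≤))))
      where
      c<p : c < p
      c<p = <ᵇ⇒< c p (proj₁ (Equivalence.to T-∧ t))
      m<λ′j : m < λ′j
      m<λ′j = ≤part⇒<conjPart l (m<n⇒0<n∸m c<p) (m∸n≤m p c)
      λ′j≡ : λ′j ≡ suc (m + d)
      λ′j≡ = trans (sym (m+[n∸m]≡n m<λ′j)) (cong (suc m +_) (≡ᵇ⇒≡ _ d (proj₂ (Equivalence.to T-∧ t))))
      j≤⇒p≤ : j ≤ f (m + d) → p ≤ f (m + d) + c
      j≤⇒p≤ j≤ = ≤-trans (m≤n+m∸n p c) (subst (_≤ f (m + d) + c) (+-comm (p ∸ c) c) (+-monoˡ-≤ c j≤))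

    from : T (removable f m) → T ((c <ᵇ p) ∧ (λ′j ∸ suc m ≡ᵇ d))
    from t = Equivalence.from T-∧ (<⇒<ᵇ c<p , ≡⇒≡ᵇ _ d (trans (cong (_∸ suc m) λ′j≡) (m+n∸m≡n m d)))
      where
      fits = proj₁ (removable⇒hook {f} {m} t)
      supports = proj₂ (removable⇒hook {f} {m} t)
      c<p : c < p
      c<p = <-≤-trans (m≤n+m (suc c) (f (m + suc d))) supports
      j≤fmd : j ≤ f (m + d)
      j≤fmd = m≤n+o⇒m∸n≤o p c (subst (p ≤_) (+-comm (f (m + d)) c) fits)
      fm1d<j : f (m + suc d) < j
      fm1d<j = m+n≤o⇒m≤o∸n (suc (f (m + suc d))) (subst (_≤ p) (+-suc (f (m + suc d)) c) supports)
      λ′j≡ : λ′j ≡ suc (m + d)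
      λ′j≡ = ≤-antisym
        (subst (λ′j ≤_) (+-suc m d) (≮⇒≥ λ m1d<λ′j → <⇒≱ fm1d<j (<conjPart⇒≤part l m1d<λ′j)))
        (≤part⇒<conjPart l (m<n⇒0<n∸m c<p) j≤fmd)

-- The cell of row m with arm c has d cells to its left exactly when row m has length c + 1 + d.
row-cell : ∀ c d f m → (c <ᵇ f m) ∧ (f m ∸ c ∸ 1 ≡ᵇ d) ≡ RowSurgery.removable (suc (c + d)) f m
row-cell c d f m = T-ext to from
  where
  h = suc (c + d)
  p = f m
  s0≡p : shift m f 0 ≡ p
  s0≡p = shift-head m f

  to : T ((c <ᵇ p) ∧ (p ∸ c ∸ 1 ≡ᵇ d)) → T (RowSurgery.removable h f m)
  to t = Equivalence.from T-∧ (≤⇒≤ᵇ (≤-reflexive (trans s0≡p p≡h)) ,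
                               ≤⇒≤ᵇ (≤-reflexive (sym (trans s0≡p p≡h))))
    where
    c<p = <ᵇ⇒< c p (proj₁ (Equivalence.to T-∧ t))
    p≡h : p ≡ h
    p≡h = begin
      p                        ≡⟨ sym (m+[n∸m]≡n (<⇒≤ c<p)) ⟩
      c + (p ∸ c)              ≡⟨ cong (c +_) (sym (suc-pred (p ∸ c) {{>-nonZero (m<n⇒0<n∸m c<p)}})) ⟩
      c + suc (p ∸ c ∸ 1)      ≡⟨ cong (λ x → c + suc x) (≡ᵇ⇒≡ _ d (proj₂ (Equivalence.to T-∧ t))) ⟩
      c + suc d                ≡⟨ +-suc c d ⟩
      h                        ∎
      where open ≡-Reasoning

  from : T (RowSurgery.removable h f m) → T ((c <ᵇ p) ∧ (p ∸ c ∸ 1 ≡ᵇ d))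
  from t = Equivalence.from T-∧ (<⇒<ᵇ (subst (c <_) (sym p≡h) (s≤s (m≤m+n c d))) , ≡⇒≡ᵇ _ d p∸c∸1≡d)
    where
    p≡h : p ≡ h
    p≡h = trans (sym s0≡p) (≤-antisym (≤ᵇ⇒≤ _ h (proj₁ (Equivalence.to T-∧ t)))
                                      (≤ᵇ⇒≤ h _ (proj₂ (Equivalence.to T-∧ t))))
    p∸c∸1≡d : p ∸ c ∸ 1 ≡ d
    p∸c∸1≡d = begin
      p ∸ c ∸ 1            ≡⟨ cong (λ x → x ∸ c ∸ 1) (trans p≡h (sym (+-suc c d))) ⟩
      c + suc d ∸ c ∸ 1    ≡⟨ cong (_∸ 1) (m+n∸m≡n c (suc d)) ⟩
      d                    ∎
      where open ≡-Reasoning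

count-cells : ∀ c d (stat : List ℕ → ℕ × ℕ → ℕ × ℕ) (R : List ℕ → ℕ → Bool) n →
  (∀ {xs} → IsPartition n xs → ∀ m → Σ< (λ j → χ-pair c d (stat xs (suc m , suc j))) (part xs m) ≡ χ (R xs m)) →
  (∀ {xs m} → part xs m ≡ 0 → ¬ T (R xs m)) →
  count (c , d) (concatMap (λ xs → map (stat xs) (cells xs)) (partitions n)) ≡
  sum (map (λ xs → Σ< (χ ∘ R xs) n) (partitions n))
count-cells c d stat R n per-row vanish = begin
  count (c , d) (concatMap (λ xs → map (stat xs) (cells xs)) (partitions n))
    ≡⟨ count-as-sum c d (concatMap (λ xs → map (stat xs) (cells xs)) (partitions n)) ⟩
  sum (map (χ-pair c d) (concatMap (λ xs → map (stat xs) (cells xs)) (partitions n)))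
    ≡⟨ sum-map-concatMap (χ-pair c d) _ (partitions n) ⟩
  sum (map (λ xs → sum (map (χ-pair c d) (map (stat xs) (cells xs)))) (partitions n))
    ≡⟨ sum-map-cong (partitions n) (λ xs∈ → per-partition (∈-partitions⁻ xs∈)) ⟩
  sum (map (λ xs → Σ< (χ ∘ R xs) n) (partitions n))
    ∎
  where
  open ≡-Reasoning
  per-partition : ∀ {xs} → IsPartition n xs → sum (map (χ-pair c d) (map (stat xs) (cells xs))) ≡ Σ< (χ ∘ R xs) n
  per-partition {xs} isP@(pos , _ , sum≡n) = begin
    sum (map (χ-pair c d) (map (stat xs) (cells xs)))       ≡⟨ cong sum (sym (map-∘ (cells xs))) ⟩
    sum (map (χ-pair c d ∘ stat xs) (cells xs))             ≡⟨ sum-cellsFrom (χ-pair c d ∘ stat xs) 0 xs ⟩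
    Σ< (λ m → Σ< (λ j → χ-pair c d (stat xs (suc m , suc j))) (part xs m)) (length xs)
                                                            ≡⟨ Σ<-cong (length xs) (λ m _ → per-row isP m) ⟩
    Σ< (χ ∘ R xs) (length xs)                               ≡⟨ sym (Σ<-tail-zero len≤n
                                                                 (λ m len≤m → χ-false (vanish (part-beyond xs len≤m)))) ⟩
    Σ< (χ ∘ R xs) n                                         ∎
    where len≤n = subst (length xs ≤_) sum≡n (length≤sum pos)

recurrence-unique : ∀ {h} (p F G : ℕ → ℕ) → 0 < h →
  (∀ {n} → n < h → F n ≡ 0) → (∀ m → F (m + h) ≡ F m + p m) →
  (∀ {n} → n < h → G n ≡ 0) → (∀ m → G (m + h) ≡ G m + p m) → F ≗ G
recurrence-unique {h} p F G 0<h F-below F-step G-below G-step = <-rec (λ n → F n ≡ G n) step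
  where
  step : ∀ n → (∀ {m} → m < n → F m ≡ G m) → F n ≡ G n
  step n ih with n <? h
  ... | yes n<h = trans (F-below n<h) (sym (G-below n<h))
  ... | no  n≮h = begin
    F n                        ≡⟨ cong F (sym n∸h+h≡n) ⟩
    F (n ∸ h + h)              ≡⟨ F-step (n ∸ h) ⟩
    F (n ∸ h) + p (n ∸ h)      ≡⟨ cong (_+ p (n ∸ h)) (ih (∸-monoʳ-< 0<h h≤n)) ⟩
    G (n ∸ h) + p (n ∸ h)      ≡⟨ sym (G-step (n ∸ h)) ⟩
    G (n ∸ h + h)              ≡⟨ cong G n∸h+h≡n ⟩
    G n                        ∎
    where
    open ≡-Reasoning
    h≤n = ≮⇒≥ n≮h
    n∸h+h≡n = m∸n+n≡m h≤n

module _ (c d : ℕ) where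
  private
    module Hook = HookSurgery.Consequences c d (hookSurgery-laws c d)
    module Row  = RowSurgery.Consequences (suc (c + d)) (rowSurgery-laws (c + d))

  A₁-count : ∀ n → count (c , d) (A₁ n) ≡ HookSurgery.removals c d n
  A₁-count n = count-cells c d (λ xs v → arm xs v , leg xs v) (HookSurgery.removable c d ∘ part) n
    (λ {xs} (_ , linked , _) m → trans (Σ<-arm c (λ j → conjPart xs j ∸ suc m ≡ᵇ d) (part xs m))
                                       (cong χ (hook-cell c d linked m)))
    (λ {xs} {m} → Hook.¬removable-vanishing {part xs} {m})

  A₂-count : ∀ n → count (c , d) (A₂ n) ≡ RowSurgery.removals (suc (c + d)) n
  A₂-count n = count-cells c d (λ xs v → arm xs v , left xs v) (RowSurgery.removable (suc (c + d)) ∘ part) n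
    (λ {xs} _ m → trans (Σ<-arm c (λ j → j ∸ 1 ≡ᵇ d) (part xs m)) (cong χ (row-cell c d (part xs) m)))
    (λ {xs} {m} → Row.¬removable-vanishing {part xs} {m})

  removals-agree : HookSurgery.removals c d ≗ RowSurgery.removals (suc (c + d))
  removals-agree = recurrence-unique (length ∘ partitions) _ _ z<s
    Hook.removals-below Hook.removals-step Row.removals-below Row.removals-step

theorem1 : (n c d : ℕ) → count (c , d) (A₁ n) ≡ count (c , d) (A₂ n)
theorem1 n c d = begin
  count (c , d) (A₁ n)                  ≡⟨ A₁-count c d n ⟩
  HookSurgery.removals c d n            ≡⟨ removals-agree c d n ⟩
  RowSurgery.removals (suc (c + d)) n   ≡⟨ sym (A₂-count c d n) ⟩
  count (c , d) (A₂ n)                  ∎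
  where open ≡-Reasoning
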